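{- Let $\Delta\ge 4$ and $d_1>0$ be integers. Let $G$ be a connected graph with at least one vertex of degree at least $2$, such that the maximum degree of $G$ is at most $\Delta$ and every vertex of degree at least $2$ has exactly $d_1$ neighbors of degree $1$. Let $v$ be a vertex of $G$ of degree at least $2$. If $d_1\notin\{\lceil \Delta/2\rceil,\lfloor \Delta/2\rfloor\}$ or $d_G(v)<\Delta$, then \[ \frac{n_0(G-N_G[v])+1}{d_G(v)}\le \frac{\lfloor \Delta^2/4\rfloor}{\Delta},\] unless $\Delta=5$, $d_G(v)=4$, and $d_1=2$.
   Context: All graphs are finite and simple. $d_G(v)$ is the degree of $v$ in $G$, $N_G[v]$ is the closed neighborhood $\{v\}\cup N_G(v)$, $G-N_G[v]$ is the subgraph induced by $V(G)\setminus N_G[v]$, and $n_0(H)$ denotes the number of isolated (degree-$0$) vertices of a graph $H$. -}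

module Defs where

open import Data.Bool using (Bool; true; false; _∧_; _∨_; not; T)
open import Data.Nat using (ℕ; suc; _≡ᵇ_)
open import Data.Fin using (Fin)
open import Data.Fin.Properties using (_≟_)
open import Data.List using (List; length; filterᵇ; allFin; foldr; map)
open import Relation.Nullary.Decidable using (⌊_⌋)
open import Relation.Binary.PropositionalEquality using (_≡_)

record Graph (n : ℕ) : Set where
  field
    adj    : Fin n → Fin n → Bool
    sym    : ∀ i j → adj i j ≡ adj j i
    irrefl : ∀ i → adj i i ≡ false
open Graph public

count : ∀ {n} → (Fin n → Bool) → ℕ
count {n} p = length (filterᵇ p (allFin n))

deg : ∀ {n} → Graph n → Fin n → ℕ
deg G v = count (adj G v)

data Walk {n : ℕ} (G : Graph n) : Fin n → Fin n → Set where
  here : ∀ {u} → Walk G u u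
  step : ∀ {u w x} → T (adj G u w) → Walk G w x → Walk G u x

Connected : ∀ {n} → Graph n → Set
Connected {n} G = ∀ (u w : Fin n) → Walk G u w

MaxDegAtMost : ∀ {n} → Graph n → ℕ → Set
MaxDegAtMost {n} G Δ = ∀ (u : Fin n) → deg G u Data.Nat.≤ Δ

leafNeighbours : ∀ {n} → Graph n → Fin n → ℕ
leafNeighbours G u = count (λ w → adj G u w ∧ (deg G w ≡ᵇ 1))

inClosedNbhd : ∀ {n} → Graph n → Fin n → Fin n → Bool
inClosedNbhd G v w = ⌊ w ≟ v ⌋ ∨ adj G v w

allB : ∀ {n} → (Fin n → Bool) → List (Fin n) → Bool
allB p xs = foldr _∧_ true (map p xs)

-- u is an isolated vertex of G - N_G[v]: u ∉ N_G[v] and every neighbour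
-- of u in G lies in N_G[v]
isolatedOutside : ∀ {n} → Graph n → Fin n → Fin n → Bool
isolatedOutside {n} G v u =
  not (inClosedNbhd G v u) ∧ allB (λ w → not (adj G u w) ∨ inClosedNbhd G v w) (allFin n)

n0Minus : ∀ {n} → Graph n → Fin n → ℕ
n0Minus G v = count (isolatedOutside G v)

{-# OPTIONS --safe #-}
-- Every neighbour of an isolated vertex u of G − N[v] lies in N(v), so it is adjacent to
-- both u and v and is not a leaf; as non-leaves carry d₁ > 0 leaves, u has no leaf
-- neighbour and must itself be a leaf, hanging at a non-leaf neighbour of v. With k
-- non-leaf neighbours of v, d(v) = d₁ + k and n₀(G − N[v]) ≤ k d₁, so it remains to show
-- (k d₁ + 1) Δ ≤ ⌊Δ²/4⌋ (d₁ + k). If d(v) = Δ this says k d₁ < ⌊Δ²/4⌋, true because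
-- d₁ ∉ {⌊Δ/2⌋, ⌈Δ/2⌉} forces |d₁ − k| ≥ 2. If d = d(v) < Δ, then 4 k d₁ ≤ d² and
-- Δ² ≤ 4⌊Δ²/4⌋ + 1 suffice as soon as d (Δ − d) ≥ 5, which leaves Δ ≤ 5 to check by
-- hand; the only failure there is Δ = 5, d(v) = 4, d₁ = k = 2.
module Submission where

open import Defs hiding (sym)
open import Data.Bool using (Bool; true; false; T; _∧_; _∨_; not)
open import Data.Bool.Properties using (T-∧; T-∨)
open import Data.Nat hiding (_≟_)
open import Data.Nat.Properties hiding (_≟_)
open import Data.Nat.DivMod
open import Data.Nat.Tactic.RingSolver using (solve-∀; solve)
open import Data.Fin using (Fin)
open import Data.Fin.Properties using (_≟_)
open import Data.List using (List; []; _∷_; length; filterᵇ; allFin)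
open import Data.List.Membership.Propositional using (_∈_)
open import Data.List.Membership.Propositional.Properties using (∈-allFin; ∈-filter⁺; ∈-filter⁻)
open import Data.List.Relation.Unary.All as All using (All)
open import Data.List.Relation.Unary.All.Properties using (all⁺)
open import Data.List.Relation.Unary.Any using (here; there)
open import Data.Empty using (⊥-elim)
open import Data.Product using (_×_; _,_; ∃; proj₁; proj₂; uncurry)
open import Data.Sum using (_⊎_; inj₁; inj₂; [_,_]′)
open import Function using (_∘_; Equivalence)
open import Relation.Nullary using (¬_; yes; no; contradiction)
open import Relation.Nullary.Decidable using (T?; fromWitness; toWitness)
open import Relation.Binary.PropositionalEquality

open Equivalence using (to; from)

¬T-not : ∀ {b} → T (not b) → ¬ T b
¬T-not {false} _ ()

module _ {A : Set} where

  countIn : (A → Bool) → List A → ℕ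
  countIn p xs = length (filterᵇ p xs)

  countIn-none : ∀ {p} xs → (∀ x → ¬ T (p x)) → countIn p xs ≡ 0
  countIn-none [] _ = refl
  countIn-none {p} (x ∷ xs) ¬p with p x in px
  ... | true  = contradiction (subst T (sym px) _) (¬p x)
  ... | false = countIn-none xs ¬p

  countIn-mono : ∀ {p q} xs → (∀ x → T (p x) → T (q x)) → countIn p xs ≤ countIn q xs
  countIn-mono [] _ = z≤n
  countIn-mono {p} {q} (x ∷ xs) p⇒q with p x in px | q x in qx
  ... | true  | true  = s≤s (countIn-mono xs p⇒q)
  ... | true  | false = contradiction (subst T qx (p⇒q x (subst T (sym px) _))) λ ()
  ... | false | true  = m≤n⇒m≤1+n (countIn-mono xs p⇒q)
  ... | false | false = countIn-mono xs p⇒q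

  countIn-split : ∀ (p q : A → Bool) xs →
    countIn p xs ≡ countIn (λ x → p x ∧ q x) xs + countIn (λ x → p x ∧ not (q x)) xs
  countIn-split p q [] = refl
  countIn-split p q (x ∷ xs) with p x | q x
  ... | true  | true  = cong suc (countIn-split p q xs)
  ... | true  | false = trans (cong suc (countIn-split p q xs)) (sym (+-suc _ _))
  ... | false | _     = countIn-split p q xs

  countIn-pos : ∀ {p x} xs → x ∈ xs → T (p x) → 1 ≤ countIn p xs
  countIn-pos {p} (y ∷ ys) (here refl) py with p y
  ... | true = s≤s z≤n
  countIn-pos {p} (y ∷ ys) (there x∈) px with p y
  ... | true  = s≤s z≤n
  ... | false = countIn-pos ys x∈ px

  countIn-≥2 : ∀ {p x y} xs → x ∈ xs → y ∈ xs → T (p x) → T (p y) → x ≢ y → 2 ≤ countIn p xs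
  countIn-≥2 (z ∷ zs) (here refl) (here refl) _ _ x≢y = contradiction refl x≢y
  countIn-≥2 {p} (z ∷ zs) (here refl) (there y∈) pz py _ with p z
  ... | true = s≤s (countIn-pos zs y∈ py)
  countIn-≥2 {p} (z ∷ zs) (there x∈) (here refl) px pz _ with p z
  ... | true = s≤s (countIn-pos zs x∈ px)
  countIn-≥2 {p} (z ∷ zs) (there x∈) (there y∈) px py x≢y with p z
  ... | true  = m≤n⇒m≤1+n (countIn-≥2 zs x∈ y∈ px py x≢y)
  ... | false = countIn-≥2 zs x∈ y∈ px py x≢y

  countIn-witness : ∀ (p : A → Bool) xs → 1 ≤ countIn p xs → ∃ λ x → T (p x)
  countIn-witness p (x ∷ xs) pos with p x in px
  ... | true  = x , subst T (sym px) _
  ... | false = countIn-witness p xs pos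

  countIn-cover : ∀ {B : Set} {P : A → Bool} (Q : B → A → Bool) ws xs {c} →
    (∀ x → T (P x) → ∃ λ w → w ∈ ws × T (Q w x)) →
    (∀ w → w ∈ ws → countIn (Q w) xs ≤ c) →
    countIn P xs ≤ length ws * c
  countIn-cover {P = P} Q [] xs cover _ = ≤-reflexive (countIn-none xs uncovered)
    where
    uncovered : ∀ x → ¬ T (P x)
    uncovered x Px with cover x Px
    ... | _ , () , _
  countIn-cover {P = P} Q (w ∷ ws) xs {c} cover bound = begin
    countIn P xs
      ≡⟨ countIn-split P (Q w) xs ⟩
    countIn (λ x → P x ∧ Q w x) xs + countIn (λ x → P x ∧ not (Q w x)) xs
      ≤⟨ +-mono-≤ covered-by-w rest ⟩
    c + length ws * c ∎
    where
    open ≤-Reasoning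
    covered-by-w : countIn (λ x → P x ∧ Q w x) xs ≤ c
    covered-by-w = ≤-trans (countIn-mono xs λ x → proj₂ ∘ to T-∧) (bound w (here refl))
    cover-rest : ∀ x → T (P x ∧ not (Q w x)) → ∃ λ w′ → w′ ∈ ws × T (Q w′ x)
    cover-rest x Px∧¬Qwx with to T-∧ Px∧¬Qwx
    ... | Px , ¬Qwx with cover x Px
    ...   | _ , here refl , Qwx = contradiction Qwx (¬T-not ¬Qwx)
    ...   | w′ , there w′∈ , Qw′x = w′ , w′∈ , Qw′x
    rest : countIn (λ x → P x ∧ not (Q w x)) xs ≤ length ws * c
    rest = countIn-cover Q ws xs cover-rest (λ w′ → bound w′ ∘ there)

2≤⇒not≡ᵇ1 : ∀ {m} → 2 ≤ m → T (not (m ≡ᵇ 1))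
2≤⇒not≡ᵇ1 (s≤s (s≤s _)) = _

not≡ᵇ1⇒2≤ : ∀ {m} → 1 ≤ m → T (not (m ≡ᵇ 1)) → 2 ≤ m
not≡ᵇ1⇒2≤ {suc (suc _)} _ _ = s≤s (s≤s z≤n)

walk-first-step : ∀ {n} {G : Graph n} {u x} → Walk G u x → u ≢ x → ∃ λ w → T (adj G u w)
walk-first-step here u≢x = contradiction refl u≢x
walk-first-step (step uw _) _ = _ , uw

module _ {n} (G : Graph n) where

  adj-sym : ∀ {u w} → T (adj G u w) → T (adj G w u)
  adj-sym {u} {w} = subst T (Graph.sym G u w)

  deg-pos : ∀ {u w} → T (adj G u w) → 1 ≤ deg G u
  deg-pos {w = w} = countIn-pos (allFin n) (∈-allFin w)

  common-nbr⇒2≤deg : ∀ {w u v} → T (adj G w u) → T (adj G w v) → u ≢ v → 2 ≤ deg G w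
  common-nbr⇒2≤deg {u = u} {v} = countIn-≥2 (allFin n) (∈-allFin u) (∈-allFin v)

  leafNbr : Fin n → Fin n → Bool
  leafNbr w u = adj G w u ∧ (deg G u ≡ᵇ 1)

  nonLeafNbr : Fin n → Fin n → Bool
  nonLeafNbr v w = adj G v w ∧ not (deg G w ≡ᵇ 1)

  deg≡leafNeighbours+nonLeaf : ∀ v → deg G v ≡ leafNeighbours G v + count (nonLeafNbr v)
  deg≡leafNeighbours+nonLeaf v = countIn-split (adj G v) (λ w → deg G w ≡ᵇ 1) (allFin n)

  nonLeafNbr⇒2≤deg : ∀ {v w} → T (nonLeafNbr v w) → 2 ≤ deg G w
  nonLeafNbr⇒2≤deg vw∧nonleaf with to T-∧ vw∧nonleaf
  ... | vw , nonleaf = not≡ᵇ1⇒2≤ (deg-pos (adj-sym vw)) nonleaf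

  module _ {v u : Fin n} (isolated : T (isolatedOutside G v u)) where

    private
      outside : ¬ T (inClosedNbhd G v u)
      outside = ¬T-not (proj₁ (to T-∧ isolated))

      nbrs-inside : All (λ w → T (not (adj G u w) ∨ inClosedNbhd G v w)) (allFin n)
      nbrs-inside = all⁺ _ (allFin n) (proj₂ (to T-∧ isolated))

    isolated⇒≢ : u ≢ v
    isolated⇒≢ refl = outside (from T-∨ (inj₁ (fromWitness {a? = u ≟ u} refl)))

    isolated-nbr⇒v-nbr : ∀ {w} → T (adj G u w) → T (adj G v w)
    isolated-nbr⇒v-nbr {w} uw with to T-∨ (All.lookup nbrs-inside (∈-allFin w))
    ... | inj₁ ¬uw = contradiction uw (¬T-not ¬uw)
    ... | inj₂ w∈N[v] with to T-∨ w∈N[v]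
    ...   | inj₂ vw = vw
    ...   | inj₁ w≡v with toWitness {a? = w ≟ v} w≡v
    ...     | refl = contradiction (from T-∨ (inj₂ (adj-sym uw))) outside

    isolated⇒leaf-of-nonLeafNbr : Connected G → (∀ x → 2 ≤ deg G x → 1 ≤ leafNeighbours G x) →
      ∃ λ w → T (nonLeafNbr v w) × T (leafNbr w u)
    isolated⇒leaf-of-nonLeafNbr conn has-leaf with walk-first-step (conn u v) isolated⇒≢
    ... | w , uw = w , from T-∧ (isolated-nbr⇒v-nbr uw , 2≤⇒not≡ᵇ1 (nbr-non-leaf uw)) ,
                       from T-∧ (adj-sym uw , ≡⇒≡ᵇ (deg G u) 1 deg≡1)
      where
      nbr-non-leaf : ∀ {x} → T (adj G u x) → 2 ≤ deg G x
      nbr-non-leaf ux = common-nbr⇒2≤deg (adj-sym ux) (adj-sym (isolated-nbr⇒v-nbr ux)) isolated⇒≢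
      deg≱2 : ¬ 2 ≤ deg G u
      deg≱2 2≤deg with countIn-witness (leafNbr u) (allFin n) (has-leaf u 2≤deg)
      ... | x , ux∧leaf with to T-∧ ux∧leaf
      ...   | ux , leaf = <⇒≢ (nbr-non-leaf ux) (sym (≡ᵇ⇒≡ (deg G x) 1 leaf))
      deg≡1 : deg G u ≡ 1
      deg≡1 = ≤-antisym (≤-pred (≰⇒> deg≱2)) (deg-pos uw)

  n0Minus≤ : Connected G → ∀ {d₁} → 0 < d₁ → (∀ u → 2 ≤ deg G u → leafNeighbours G u ≡ d₁) →
    ∀ v → n0Minus G v ≤ count (nonLeafNbr v) * d₁
  n0Minus≤ conn {d₁} 0<d₁ leaf-regular v = countIn-cover leafNbr nonLeafNbrs (allFin n) cover bound
    where
    nonLeafNbrs : List (Fin n)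
    nonLeafNbrs = filterᵇ (nonLeafNbr v) (allFin n)
    has-leaf : ∀ x → 2 ≤ deg G x → 1 ≤ leafNeighbours G x
    has-leaf x 2≤deg = subst (1 ≤_) (sym (leaf-regular x 2≤deg)) 0<d₁
    cover : ∀ u → T (isolatedOutside G v u) → ∃ λ w → w ∈ nonLeafNbrs × T (leafNbr w u)
    cover u isolated with isolated⇒leaf-of-nonLeafNbr isolated conn has-leaf
    ... | w , vw , wu = w , ∈-filter⁺ (T? ∘ nonLeafNbr v) (∈-allFin w) vw , wu
    bound : ∀ w → w ∈ nonLeafNbrs → leafNeighbours G w ≤ d₁
    bound w w∈ = ≤-reflexive (leaf-regular w (nonLeafNbr⇒2≤deg vw))
      where
      vw : T (nonLeafNbr v w)
      vw = proj₂ (∈-filter⁻ (T? ∘ nonLeafNbr v) {xs = allFin n} w∈)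

m*n≤o⇒m≤o/n : ∀ m {n o} .{{_ : NonZero n}} → m * n ≤ o → m ≤ o / n
m*n≤o⇒m≤o/n m {n} m*n≤o = subst (_≤ _) (m*n/n≡m m n) (/-monoˡ-≤ n m*n≤o)

[m*n+r]/n≡m : ∀ m {n r} .{{_ : NonZero n}} → r < n → (m * n + r) / n ≡ m
[m*n+r]/n≡m m {n} {r} r<n = ≤-antisym (≤-pred (m<n*o⇒m/o<n upper)) (m*n≤o⇒m≤o/n m (m≤m+n (m * n) r))
  where
  upper : m * n + r < suc m * n
  upper = begin-strict
    m * n + r <⟨ +-monoʳ-< (m * n) r<n ⟩
    m * n + n ≡⟨ +-comm (m * n) n ⟩
    suc m * n ∎
    where open ≤-Reasoning

m*m≤[m*m/4]*4+1 : ∀ m → m * m ≤ (m * m / 4) * 4 + 1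
m*m≤[m*m/4]*4+1 m = begin
  m * m                       ≡⟨ square≡ ⟩
  (k * k + k * r) * 4 + r * r ≤⟨ +-monoʳ-≤ _ r*r≤1 ⟩
  (k * k + k * r) * 4 + 1     ≡⟨ cong (λ z → z * 4 + 1) quotient ⟨
  (m * m / 4) * 4 + 1         ∎
  where
  open ≤-Reasoning
  r k : ℕ
  r = m % 2
  k = m / 2
  r*r≤1 : r * r ≤ 1
  r*r≤1 = *-mono-≤ (≤-pred (m%n<n m 2)) (≤-pred (m%n<n m 2))
  expand : ∀ r k → (r + k * 2) * (r + k * 2) ≡ (k * k + k * r) * 4 + r * r
  expand = solve-∀
  square≡ : m * m ≡ (k * k + k * r) * 4 + r * r
  square≡ = trans (cong (λ z → z * z) (m≡m%n+[m/n]*n m 2)) (expand r k)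
  quotient : m * m / 4 ≡ k * k + k * r
  quotient = trans (/-congˡ square≡) ([m*n+r]/n≡m _ (s≤s (≤-trans r*r≤1 (s≤s z≤n))))

[m+[m+a]]²≡m[m+a]*4+a² : ∀ m a → (m + (m + a)) * (m + (m + a)) ≡ m * (m + a) * 4 + a * a
[m+[m+a]]²≡m[m+a]*4+a² = solve-∀

m*n≤[m+n]²/4 : ∀ m n → m * n ≤ (m + n) * (m + n) / 4
m*n≤[m+n]²/4 m n = m*n≤o⇒m≤o/n (m * n) ([ ordered , swapped ]′ (≤-total m n))
  where
  ordered : ∀ {m n} → m ≤ n → m * n * 4 ≤ (m + n) * (m + n)
  ordered {m} m≤n with m≤n⇒∃[o]m+o≡n m≤n
  ... | a , refl = subst (m * (m + a) * 4 ≤_) (sym ([m+[m+a]]²≡m[m+a]*4+a² m a)) (m≤m+n _ (a * a))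
  swapped : n ≤ m → m * n * 4 ≤ (m + n) * (m + n)
  swapped n≤m = subst₂ (λ p s → p * 4 ≤ s) (*-comm n m) (cong₂ _*_ (+-comm n m) (+-comm n m)) (ordered n≤m)

m*n+1≤[m+n]²/4 : ∀ {m n} → 2 + m ≤ n ⊎ 2 + n ≤ m → m * n + 1 ≤ (m + n) * (m + n) / 4
m*n+1≤[m+n]²/4 {m} {n} = [ ordered , swapped ]′
  where
  ordered : ∀ {m n} → 2 + m ≤ n → m * n + 1 ≤ (m + n) * (m + n) / 4
  ordered {m} 2+m≤n with m≤n⇒∃[o]m+o≡n (≤-trans (m≤n+m m 2) 2+m≤n)
  ... | a , refl = m*n≤o⇒m≤o/n _ (begin
    (m * (m + a) + 1) * 4         ≡⟨ solve (m ∷ a ∷ []) ⟩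
    m * (m + a) * 4 + 2 * 2       ≤⟨ +-monoʳ-≤ _ (*-mono-≤ 2≤a 2≤a) ⟩
    m * (m + a) * 4 + a * a       ≡⟨ [m+[m+a]]²≡m[m+a]*4+a² m a ⟨
    (m + (m + a)) * (m + (m + a)) ∎)
    where
    open ≤-Reasoning
    2≤a : 2 ≤ a
    2≤a = +-cancelˡ-≤ m 2 a (subst (_≤ m + a) (+-comm 2 m) 2+m≤n)
  swapped : 2 + n ≤ m → m * n + 1 ≤ (m + n) * (m + n) / 4
  swapped 2+n≤m = subst₂ (λ p s → p + 1 ≤ s * s / 4) (*-comm n m) (+-comm n m) (ordered 2+n≤m)

apart-from-halves : ∀ m n → m ≢ (m + n + 1) / 2 → m ≢ (m + n) / 2 → 2 + m ≤ n ⊎ 2 + n ≤ m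
apart-from-halves m n m≢⌈⌉ m≢⌊⌋ = [ above , below ]′ (≤-total m n)
  where
  half : ∀ k o {r} → r < 2 → o ≡ k * 2 + r → k ≡ o / 2
  half k o r<2 o≡ = sym (trans (/-congˡ o≡) ([m*n+r]/n≡m k r<2))

  2+k≤k+[2+b] : ∀ k b → 2 + k ≤ k + (2 + b)
  2+k≤k+[2+b] k b = subst (_≤ k + (2 + b)) (+-comm k 2) (+-monoʳ-≤ k (m≤m+n 2 b))

  above : m ≤ n → 2 + m ≤ n ⊎ 2 + n ≤ m
  above m≤n with m≤n⇒∃[o]m+o≡n m≤n
  ... | 0 , refl = contradiction (half m (m + (m + 0)) (s≤s z≤n) (solve (m ∷ []))) m≢⌊⌋
  ... | 1 , refl = contradiction (half m (m + (m + 1)) (s≤s (s≤s z≤n)) (solve (m ∷ []))) m≢⌊⌋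
  ... | suc (suc b) , refl = inj₁ (2+k≤k+[2+b] m b)

  below : n ≤ m → 2 + m ≤ n ⊎ 2 + n ≤ m
  below n≤m with m≤n⇒∃[o]m+o≡n n≤m
  ... | 0 , refl = contradiction (half (n + 0) (n + 0 + n) (s≤s z≤n) (solve (n ∷ []))) m≢⌊⌋
  ... | 1 , refl = contradiction (half (n + 1) (n + 1 + n + 1) (s≤s z≤n) (solve (n ∷ []))) m≢⌈⌉
  ... | suc (suc b) , refl = inj₂ (2+k≤k+[2+b] n b)

m+n≤1+m*n : ∀ {m n} → 1 ≤ m → 1 ≤ n → m + n ≤ suc (m * n)
m+n≤1+m*n {suc m} {suc n} _ _ = s≤s (begin
  m + suc n         ≡⟨ +-comm m (suc n) ⟩
  suc n + m         ≤⟨ +-monoʳ-≤ (suc n) (m≤m*n m (suc n)) ⟩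
  suc n + m * suc n ∎)
  where open ≤-Reasoning

product-bound-large-gap : ∀ {p d Δ} s → d + s ≡ Δ → p ≤ d * d / 4 → 5 ≤ d * s →
  (p + 1) * Δ ≤ (Δ * Δ / 4) * d
product-bound-large-gap {p} {d} s refl p≤d²/4 5≤ds = *-cancelˡ-≤ 4 (+-cancelʳ-≤ d _ _ (begin
  4 * ((p + 1) * (d + s)) + d               ≡⟨ solve (p ∷ d ∷ s ∷ []) ⟩
  p * 4 * (d + s) + (4 * (d + s) + d)       ≤⟨ +-mono-≤ (*-monoˡ-≤ (d + s) 4p≤d²) (+-monoʳ-≤ _ (m≤m+n d s)) ⟩
  d * d * (d + s) + (4 * (d + s) + (d + s)) ≡⟨ solve (d ∷ s ∷ []) ⟩
  d * d * (d + s) + (d + s) * 5             ≤⟨ +-monoʳ-≤ (d * d * (d + s)) (*-monoʳ-≤ (d + s) 5≤ds) ⟩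
  d * d * (d + s) + (d + s) * (d * s)       ≡⟨ solve (d ∷ s ∷ []) ⟩
  (d + s) * (d + s) * d                     ≤⟨ *-monoˡ-≤ d (m*m≤[m*m/4]*4+1 (d + s)) ⟩
  ((d + s) * (d + s) / 4 * 4 + 1) * d       ≡⟨ regroup ((d + s) * (d + s) / 4) d ⟩
  4 * ((d + s) * (d + s) / 4 * d) + d       ∎))
  where
  open ≤-Reasoning
  4p≤d² : p * 4 ≤ d * d
  4p≤d² = ≤-trans (*-monoˡ-≤ 4 p≤d²/4) (m/n*n≤m (d * d) 4)
  regroup : ∀ q d → (q * 4 + 1) * d ≡ 4 * (q * d) + d
  regroup = solve-∀

product-bound-small-Δ : ∀ {p} Δ d → 4 ≤ Δ → Δ < 6 → 2 ≤ d → d < Δ → p ≤ d * d / 4 →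
  (Δ ≡ 5 → d ≡ 4 → p + 1 ≤ d * d / 4) → (p + 1) * Δ ≤ (Δ * Δ / 4) * d
product-bound-small-Δ 4 2 _ _ _ _ p≤ _   = ≤-trans (*-monoˡ-≤ 4 (+-monoˡ-≤ 1 p≤)) (≤ᵇ⇒≤ _ _ _)
product-bound-small-Δ 4 3 _ _ _ _ p≤ _   = ≤-trans (*-monoˡ-≤ 4 (+-monoˡ-≤ 1 p≤)) (≤ᵇ⇒≤ _ _ _)
product-bound-small-Δ 5 2 _ _ _ _ p≤ _   = ≤-trans (*-monoˡ-≤ 5 (+-monoˡ-≤ 1 p≤)) (≤ᵇ⇒≤ _ _ _)
product-bound-small-Δ 5 3 _ _ _ _ p≤ _   = ≤-trans (*-monoˡ-≤ 5 (+-monoˡ-≤ 1 p≤)) (≤ᵇ⇒≤ _ _ _)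
product-bound-small-Δ 5 4 _ _ _ _ _  gap = ≤-trans (*-monoˡ-≤ 5 (gap refl refl)) (≤ᵇ⇒≤ _ _ _)
product-bound-small-Δ _ 0 _ _ () _ _ _
product-bound-small-Δ _ 1 _ _ (s≤s ()) _ _ _
product-bound-small-Δ 1 _ (s≤s ()) _ _ _ _ _
product-bound-small-Δ 2 _ (s≤s (s≤s ())) _ _ _ _ _
product-bound-small-Δ 3 _ (s≤s (s≤s (s≤s ()))) _ _ _ _ _
product-bound-small-Δ 4 (suc (suc (suc (suc _)))) _ _ _ (s≤s (s≤s (s≤s (s≤s ())))) _ _
product-bound-small-Δ 5 (suc (suc (suc (suc (suc _))))) _ _ _ (s≤s (s≤s (s≤s (s≤s (s≤s ()))))) _ _
product-bound-small-Δ (suc (suc (suc (suc (suc (suc _)))))) _ _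
  (s≤s (s≤s (s≤s (s≤s (s≤s (s≤s ())))))) _ _ _ _

product-bound-below-max : ∀ {p} Δ d → 4 ≤ Δ → 2 ≤ d → d < Δ → p ≤ d * d / 4 →
  (Δ ≡ 5 → d ≡ 4 → p + 1 ≤ d * d / 4) → (p + 1) * Δ ≤ (Δ * Δ / 4) * d
product-bound-below-max Δ d 4≤Δ 2≤d d<Δ p≤d²/4 gap with 6 ≤? Δ
... | no 6≰Δ = product-bound-small-Δ Δ d 4≤Δ (≰⇒> 6≰Δ) 2≤d d<Δ p≤d²/4 gap
... | yes 6≤Δ with m≤n⇒∃[o]m+o≡n d<Δ
...   | o , 1+d+o≡Δ = product-bound-large-gap (suc o) d+s≡Δ p≤d²/4 5≤ds
  where
  d+s≡Δ : d + suc o ≡ Δ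
  d+s≡Δ = trans (+-suc d o) 1+d+o≡Δ
  5≤ds : 5 ≤ d * suc o
  5≤ds = ≤-pred (begin
    6               ≤⟨ 6≤Δ ⟩
    Δ               ≡⟨ d+s≡Δ ⟨
    d + suc o       ≤⟨ m+n≤1+m*n (≤-trans (s≤s z≤n) 2≤d) (s≤s z≤n) ⟩
    suc (d * suc o) ∎)
    where open ≤-Reasoning

n*m+1≤[m+n]²/4 : ∀ m n → m ≢ (m + n + 1) / 2 → m ≢ (m + n) / 2 → n * m + 1 ≤ (m + n) * (m + n) / 4
n*m+1≤[m+n]²/4 m n m≢⌈⌉ m≢⌊⌋ =
  subst (λ p → p + 1 ≤ (m + n) * (m + n) / 4) (*-comm m n)
    (m*n+1≤[m+n]²/4 (apart-from-halves m n m≢⌈⌉ m≢⌊⌋))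

split-product-bound : ∀ {Δ d} a b → a + b ≡ d → 4 ≤ Δ → 2 ≤ d → d ≤ Δ →
  ((a ≢ (Δ + 1) / 2 × a ≢ Δ / 2) ⊎ d < Δ) → ¬ (Δ ≡ 5 × d ≡ 4 × a ≡ 2) →
  (b * a + 1) * Δ ≤ (Δ * Δ / 4) * d
split-product-bound {Δ} a b refl 4≤Δ 2≤d d≤Δ unbalanced exc with m≤n⇒m<n∨m≡n d≤Δ
... | inj₂ refl = *-monoˡ-≤ (a + b) ([ uncurry (n*m+1≤[m+n]²/4 a b) , ⊥-elim ∘ <-irrefl refl ]′ unbalanced)
... | inj₁ d<Δ = product-bound-below-max Δ (a + b) 4≤Δ 2≤d d<Δ p≤d²/4 balanced-excluded
  where
  p≤d²/4 : b * a ≤ (a + b) * (a + b) / 4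
  p≤d²/4 = subst (λ d → b * a ≤ d * d / 4) (+-comm b a) (m*n≤[m+n]²/4 b a)
  balanced-excluded : Δ ≡ 5 → a + b ≡ 4 → b * a + 1 ≤ (a + b) * (a + b) / 4
  balanced-excluded Δ≡5 d≡4 = n*m+1≤[m+n]²/4 a b
      (λ e → a≢2 (trans e (cong (λ d → (d + 1) / 2) d≡4))) (λ e → a≢2 (trans e (cong (_/ 2) d≡4)))
    where
    a≢2 : a ≢ 2
    a≢2 a≡2 = exc (Δ≡5 , d≡4 , a≡2)

lemma2p6 : (Δ d₁ : ℕ) → 4 ≤ Δ → 0 < d₁ →
    (n : ℕ) (G : Graph n) → Connected G →
    ∃ (λ (u : Fin n) → 2 ≤ deg G u) →
    MaxDegAtMost G Δ →
    (∀ (u : Fin n) → 2 ≤ deg G u → leafNeighbours G u ≡ d₁) →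
    (v : Fin n) → 2 ≤ deg G v →
    ((d₁ ≢ (Δ + 1) / 2 × d₁ ≢ Δ / 2) ⊎ deg G v < Δ) →
    ¬ (Δ ≡ 5 × deg G v ≡ 4 × d₁ ≡ 2) →
    (n0Minus G v + 1) * Δ ≤ ((Δ * Δ) / 4) * deg G v
lemma2p6 Δ d₁ 4≤Δ 0<d₁ n G conn _ maxDeg leaf-regular v 2≤deg unbalanced exc = begin
  (n0Minus G v + 1) * Δ
    ≤⟨ *-monoˡ-≤ Δ (+-monoˡ-≤ 1 (n0Minus≤ G conn 0<d₁ leaf-regular v)) ⟩
  (k * d₁ + 1) * Δ
    ≤⟨ split-product-bound d₁ k (sym deg≡d₁+k) 4≤Δ 2≤deg (maxDeg v) unbalanced exc ⟩
  (Δ * Δ / 4) * deg G v ∎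
  where
  open ≤-Reasoning
  k : ℕ
  k = count (nonLeafNbr G v)
  deg≡d₁+k : deg G v ≡ d₁ + k
  deg≡d₁+k = trans (deg≡leafNeighbours+nonLeaf G v) (cong (_+ k) (leaf-regular v 2≤deg))
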